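{- Let $g\ge 6$ be an integer. Then there is no gapset of genus $g$ and depth $q$ for any integer $q\in\left[\left\lceil \frac{2g}{3}\right\rceil+1,\ g-1\right]$.
   Context: A gapset is a finite set $G\subset\mathbb N$ (positive integers) such that whenever $z\in G$ and $z=x+y$ with $x,y\in\mathbb N$, then $x\in G$ or $y\in G$. Its genus is $\#G$, its multiplicity is $m(G)=\min\{s\in\mathbb N_0\setminus G: s\ne0\}$, its conductor is $c(G)=\min\{s\in\mathbb N_0: s+n\notin G\ \forall n\in\mathbb N_0\}$, and its depth is $\lceil c(G)/m(G)\rceil$. $[a,b]=\{x\in\mathbb Z: a\le x\le b\}$. -}

module Defs where

open import Data.Nat using (ℕ; zero; suc; _+_; _*_; _≤_; _<_)
open import Data.Nat.DivMod using (_/_)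
open import Data.List using (List; length)
open import Data.List.Membership.Propositional using (_∈_; _∉_)
open import Data.List.Relation.Unary.All using (All)
open import Data.List.Relation.Unary.Unique.Propositional using (Unique)
open import Data.Product using (_×_; ∃-syntax)
open import Data.Sum using (_⊎_)
open import Relation.Binary.PropositionalEquality using (_≡_)

record IsGapset (G : List ℕ) : Set where
  field
    unique   : Unique G
    positive : All (λ z → 1 ≤ z) G
    closed   : ∀ {z} → z ∈ G → ∀ x y → 1 ≤ x → 1 ≤ y → z ≡ x + y → x ∈ G ⊎ y ∈ G

genus : List ℕ → ℕ
genus = length

IsMultiplicity : List ℕ → ℕ → Set
IsMultiplicity G m = (1 ≤ m × m ∉ G) × (∀ s → 1 ≤ s → s ∉ G → m ≤ s)

IsConductor : List ℕ → ℕ → Set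
IsConductor G c = (∀ n → c + n ∉ G) × (∀ s → (∀ n → s + n ∉ G) → c ≤ s)

-- ceiling division ⌈a / b⌉ (value at b = 0 is irrelevant and set to 0)
⌈_/_⌉ : ℕ → ℕ → ℕ
⌈ a / zero ⌉ = 0
⌈ a / suc k ⌉ = (a + k) / suc k

module Submission where

-- Split on the multiplicity m. For m = 1 the gapset is empty. For m = 2 no even
-- number is a gap, so at most ⌈c/2⌉ of the numbers below c are gaps: g ≤ depth.
-- For m ≥ 3 use c ≤ 2g: the Frobenius number f = c − 1 is a gap and for every
-- x ≤ f one of x, f − x is a gap, so counting the gaps below c twice covers all
-- of 0, …, f; hence the depth ⌈c/m⌉ is at most ⌈2g/3⌉.

open import Defs
open import Data.Nat using (ℕ; zero; suc; _+_; _*_; _∸_; _≤_; _<_; z≤n; s≤s; s≤s⁻¹; NonZero; _≟_)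
open import Data.Nat.Properties
open import Algebra.Properties.CommutativeSemigroup +-commutativeSemigroup using (interchange)
open import Data.Nat.DivMod using (_/_; _%_; m≡m%n+[m/n]*n; m%n<n; m<n*o⇒m/o<n)
open import Data.List using (List; []; _∷_; length)
open import Data.List.Membership.Propositional using (_∈_; _∉_)
open import Data.List.Membership.DecPropositional _≟_ using (_∈?_)
open import Data.List.Relation.Unary.Any using (here; there)
open import Data.List.Relation.Unary.All using (All; []; _∷_; lookup; tabulate)
open import Data.List.Relation.Unary.All.Properties using (All¬⇒¬Any)
open import Data.List.Relation.Unary.AllPairs using ([]; _∷_)
open import Data.List.Relation.Unary.Unique.Propositional using (Unique)
open import Data.Product using (_,_)
open import Data.Sum using (_⊎_; inj₁; inj₂; [_,_])
open import Relation.Binary.PropositionalEquality using (_≡_; refl; sym; trans; cong; cong₂; subst; module ≡-Reasoning)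
open import Relation.Nullary using (¬_; Dec; yes; no; contradiction)

private variable
  a b m n : ℕ
  f h : ℕ → ℕ
  G : List ℕ

∑< : ℕ → (ℕ → ℕ) → ℕ
∑< zero    f = 0
∑< (suc n) f = ∑< n f + f n

syntax ∑< n (λ i → e) = ∑[ i < n ] e

∑-cong : (∀ i → f i ≡ h i) → ∀ n → ∑< n f ≡ ∑< n h
∑-cong f≡h zero    = refl
∑-cong f≡h (suc n) = cong₂ _+_ (∑-cong f≡h n) (f≡h n)

∑-zero : ∀ n → ∑[ i < n ] 0 ≡ 0
∑-zero zero    = refl
∑-zero (suc n) = trans (+-identityʳ _) (∑-zero n)

∑-distrib-+ : ∀ n → ∑[ i < n ] (f i + h i) ≡ ∑< n f + ∑< n h
∑-distrib-+ zero = refl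
∑-distrib-+ {f} {h} (suc n) =
  trans (cong (_+ (f n + h n)) (∑-distrib-+ n)) (interchange (∑< n f) (∑< n h) (f n) (h n))

∑-monoˡ-≤ : m ≤ n → ∑< m f ≤ ∑< n f
∑-monoˡ-≤ {n = zero}      z≤n = ≤-refl
∑-monoˡ-≤ {m} {suc n} {f} m≤1+n with m≤n⇒m<n∨m≡n m≤1+n
... | inj₁ (s≤s m≤n) = ≤-trans (∑-monoˡ-≤ m≤n) (m≤m+n (∑< n f) (f n))
... | inj₂ refl      = ≤-refl

n≤∑ : ∀ n → (∀ i → i < n → 1 ≤ f i) → n ≤ ∑< n f
n≤∑ zero    _       = z≤n
n≤∑ {f} (suc n) 1≤f = subst (_≤ ∑< n f + f n) (+-comm n 1)
  (+-mono-≤ (n≤∑ n λ i i<n → 1≤f i (m<n⇒m<1+n i<n)) (1≤f n ≤-refl))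

∑-unshift : ∀ n → ∑< (suc n) f ≡ f 0 + ∑[ i < n ] f (suc i)
∑-unshift {f} zero    = +-comm 0 (f 0)
∑-unshift {f} (suc n) = trans (cong (_+ f (suc n)) (∑-unshift n)) (+-assoc (f 0) _ _)

∑-reverse : ∀ n → ∑[ i < suc n ] f (n ∸ i) ≡ ∑< (suc n) f
∑-reverse zero = refl
∑-reverse {f} (suc n) = begin
  ∑[ i < suc (suc n) ] f (suc n ∸ i)  ≡⟨ ∑-unshift (suc n) ⟩
  f (suc n) + ∑[ i < suc n ] f (n ∸ i) ≡⟨ cong (f (suc n) +_) (∑-reverse n) ⟩
  f (suc n) + ∑< (suc n) f            ≡⟨ +-comm (f (suc n)) _ ⟩
  ∑< (suc (suc n)) f                  ∎
  where open ≡-Reasoning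

𝟙 : {P : Set} → Dec P → ℕ
𝟙 (yes _) = 1
𝟙 (no _)  = 0

module _ {P : Set} where

  𝟙-yes : (P? : Dec P) → P → 𝟙 P? ≡ 1
  𝟙-yes (yes _) _ = refl
  𝟙-yes (no ¬p) p = contradiction p ¬p

  𝟙-no : (P? : Dec P) → ¬ P → 𝟙 P? ≡ 0
  𝟙-no (yes p) ¬p = contradiction p ¬p
  𝟙-no (no _)  _  = refl

  𝟙≤1 : (P? : Dec P) → 𝟙 P? ≤ 1
  𝟙≤1 (yes _) = ≤-refl
  𝟙≤1 (no _)  = z≤n

∑-𝟙≡-below : ∀ x n → n ≤ x → ∑[ i < n ] 𝟙 (i ≟ x) ≡ 0
∑-𝟙≡-below x zero    _     = refl
∑-𝟙≡-below x (suc n) 1+n≤x = cong₂ _+_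
  (∑-𝟙≡-below x n (<⇒≤ 1+n≤x)) (𝟙-no (n ≟ x) (<⇒≢ 1+n≤x))

∑-𝟙≡-above : ∀ x n → x < n → ∑[ i < n ] 𝟙 (i ≟ x) ≡ 1
∑-𝟙≡-above x (suc n) (s≤s x≤n) with m≤n⇒m<n∨m≡n x≤n
... | inj₁ x<n = cong₂ _+_ (∑-𝟙≡-above x n x<n) (𝟙-no (n ≟ x) (>⇒≢ x<n))
... | inj₂ refl = cong₂ _+_ (∑-𝟙≡-below x x ≤-refl) (𝟙-yes (x ≟ x) refl)

countBelow : ℕ → List ℕ → ℕ
countBelow n G = ∑[ i < n ] 𝟙 (i ∈? G)

-- Stated for arbitrary decisions so that _∈?_ never has to be unfolded.
𝟙-∈-∷ : ∀ {x i} → x ∉ G →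
         (i∈x∷G? : Dec (i ∈ x ∷ G)) (i∈G? : Dec (i ∈ G)) (i≡x? : Dec (i ≡ x)) →
         𝟙 i∈x∷G? ≡ 𝟙 i∈G? + 𝟙 i≡x?
𝟙-∈-∷ x∉G (yes _)         (yes _)   (no _)     = refl
𝟙-∈-∷ x∉G (yes _)         (no _)    (yes _)    = refl
𝟙-∈-∷ x∉G (no _)          (no _)    (no _)     = refl
𝟙-∈-∷ x∉G _               (yes i∈G) (yes refl) = contradiction i∈G x∉G
𝟙-∈-∷ x∉G (yes (here i≡x)) (no _)   (no i≢x)   = contradiction i≡x i≢x
𝟙-∈-∷ x∉G (yes (there i∈G)) (no i∉G) (no _)    = contradiction i∈G i∉G
𝟙-∈-∷ x∉G (no i∉x∷G)      (yes i∈G) (no _)     = contradiction (there i∈G) i∉x∷G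
𝟙-∈-∷ x∉G (no i∉x∷G)      (no _)    (yes refl) = contradiction (here refl) i∉x∷G

countBelow≡length : ∀ n → Unique G → All (_< n) G → countBelow n G ≡ length G
countBelow≡length n [] [] = ∑-zero n
countBelow≡length {x ∷ G} n (x≢G ∷ unique) (x<n ∷ G<n) = begin
  countBelow n (x ∷ G)                           ≡⟨ ∑-cong (λ i → 𝟙-∈-∷ (All¬⇒¬Any x≢G) (i ∈? x ∷ G) (i ∈? G) (i ≟ x)) n ⟩
  ∑[ i < n ] (𝟙 (i ∈? G) + 𝟙 (i ≟ x))           ≡⟨ ∑-distrib-+ n ⟩
  countBelow n G + ∑[ i < n ] 𝟙 (i ≟ x)          ≡⟨ cong₂ _+_ (countBelow≡length n unique G<n) (∑-𝟙≡-above x n x<n) ⟩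
  length G + 1                                   ≡⟨ +-comm (length G) 1 ⟩
  length (x ∷ G)                                 ∎
  where open ≡-Reasoning

countBelow-evens∉ : (∀ k → k * 2 ∉ G) → ∀ k → countBelow (k * 2) G ≤ k
countBelow-evens∉ evens∉ zero = z≤n
countBelow-evens∉ {G} evens∉ (suc k) = begin
  countBelow (k * 2) G + 𝟙 (k * 2 ∈? G) + 𝟙 (suc (k * 2) ∈? G)
    ≤⟨ +-mono-≤ (+-mono-≤ (countBelow-evens∉ evens∉ k) (≤-reflexive (𝟙-no _ (evens∉ k)))) (𝟙≤1 _) ⟩
  k + 0 + 1 ≡⟨ cong (_+ 1) (+-identityʳ k) ⟩
  k + 1     ≡⟨ +-comm k 1 ⟩
  suc k     ∎
  where open ≤-Reasoning

≤⌈/⌉* : ∀ a m .{{_ : NonZero m}} → a ≤ ⌈ a / m ⌉ * m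
≤⌈/⌉* a (suc k) = +-cancelʳ-≤ k a (⌈ a / suc k ⌉ * suc k) (begin
  a + k                                     ≡⟨ m≡m%n+[m/n]*n (a + k) (suc k) ⟩
  (a + k) % suc k + ⌈ a / suc k ⌉ * suc k  ≤⟨ +-monoˡ-≤ _ (s≤s⁻¹ (m%n<n (a + k) (suc k))) ⟩
  k + ⌈ a / suc k ⌉ * suc k                 ≡⟨ +-comm k _ ⟩
  ⌈ a / suc k ⌉ * suc k + k                 ∎)
  where open ≤-Reasoning

⌈/⌉-least : ∀ {a q} m .{{_ : NonZero m}} → a ≤ q * m → ⌈ a / m ⌉ ≤ q
⌈/⌉-least {a} {q} (suc k) a≤q*m = s≤s⁻¹ (m<n*o⇒m/o<n
  (subst (_≤ suc k + q * suc k) (cong suc (+-comm k a)) (s≤s (+-monoʳ-≤ k a≤q*m))))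

⌈/⌉-monoˡ-≤ : ∀ m .{{_ : NonZero m}} → a ≤ b → ⌈ a / m ⌉ ≤ ⌈ b / m ⌉
⌈/⌉-monoˡ-≤ {b = b} m a≤b = ⌈/⌉-least m (≤-trans a≤b (≤⌈/⌉* b m))

⌈/⌉-monoʳ-≥ : ∀ a {m n} .{{_ : NonZero m}} .{{_ : NonZero n}} → m ≤ n → ⌈ a / n ⌉ ≤ ⌈ a / m ⌉
⌈/⌉-monoʳ-≥ a {m} {n} m≤n = ⌈/⌉-least n (≤-trans (≤⌈/⌉* a m) (*-monoʳ-≤ ⌈ a / m ⌉ m≤n))

All<conductor : ∀ {c} → IsConductor G c → All (_< c) G
All<conductor {G} {c} (c+n∉G , _) = tabulate λ {z} z∈G → ≰⇒> λ c≤z →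
  c+n∉G (z ∸ c) (subst (_∈ G) (sym (m+[n∸m]≡n c≤z)) z∈G)

conductor-pred∈ : ∀ {f} → IsConductor G (suc f) → f ∈ G
conductor-pred∈ {G} {f} (1+f+n∉G , least) with f ∈? G
... | yes f∈G = f∈G
... | no f∉G  = contradiction (least f f+n∉G) (n≮n f)
  where
  f+n∉G : ∀ n → f + n ∉ G
  f+n∉G zero    = subst (_∉ G) (sym (+-identityʳ f)) f∉G
  f+n∉G (suc n) = subst (_∉ G) (sym (+-suc f n)) (1+f+n∉G n)

countBelow-conductor : ∀ {c} → Unique G → IsConductor G c → countBelow c G ≡ genus G
countBelow-conductor {c = c} unique cond = countBelow≡length c unique (All<conductor cond)

module _ (isGapset : IsGapset G) where
  open IsGapset isGapset

  multiples∉ : 1 ≤ m → m ∉ G → ∀ k → k * m ∉ G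
  multiples∉ _   _   zero                 0∈G = contradiction (lookup positive 0∈G) (λ ())
  multiples∉ {m} _   m∉G (suc zero)       m∈G = m∉G (subst (_∈ G) (+-identityʳ m) m∈G)
  multiples∉ {m} 1≤m m∉G (suc k@(suc _)) km∈G =
    [ m∉G , multiples∉ 1≤m m∉G k ] (closed km∈G m (k * m) 1≤m (≤-trans 1≤m (m≤n*m m k)) refl)

  gap-split : ∀ {f} → f ∈ G → ∀ x → x ≤ f → x ∈ G ⊎ f ∸ x ∈ G
  gap-split f∈G zero _ = inj₂ f∈G
  gap-split {f} f∈G x@(suc _) x≤f with m≤n⇒m<n∨m≡n x≤f
  ... | inj₁ x<f = closed f∈G x (f ∸ x) (s≤s z≤n) (m<n⇒0<n∸m x<f) (sym (m+[n∸m]≡n x≤f))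
  ... | inj₂ refl = inj₁ f∈G

  conductor≤2*genus : ∀ {c} → IsConductor G c → c ≤ 2 * genus G
  conductor≤2*genus {zero}  _    = z≤n
  conductor≤2*genus {suc f} cond = begin
    suc f                                              ≤⟨ n≤∑ (suc f) (λ x x≤f → 𝟙-split x (s≤s⁻¹ x≤f)) ⟩
    ∑[ x < suc f ] (𝟙 (x ∈? G) + 𝟙 (f ∸ x ∈? G))      ≡⟨ ∑-distrib-+ (suc f) ⟩
    countBelow (suc f) G + ∑[ x < suc f ] 𝟙 (f ∸ x ∈? G) ≡⟨ cong (countBelow (suc f) G +_) (∑-reverse f) ⟩
    countBelow (suc f) G + countBelow (suc f) G        ≡⟨ cong (λ n → n + n) (countBelow-conductor unique cond) ⟩
    genus G + genus G                                  ≡⟨ cong (genus G +_) (sym (+-identityʳ (genus G))) ⟩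
    2 * genus G                                        ∎
    where
    open ≤-Reasoning
    𝟙-split : ∀ x → x ≤ f → 1 ≤ 𝟙 (x ∈? G) + 𝟙 (f ∸ x ∈? G)
    𝟙-split x x≤f = [ (λ x∈G → ≤-trans (≤-reflexive (sym (𝟙-yes (x ∈? G) x∈G))) (m≤m+n _ _))
                    , (λ f∸x∈G → ≤-trans (≤-reflexive (sym (𝟙-yes (f ∸ x ∈? G) f∸x∈G))) (m≤n+m _ _))
                    ] (gap-split (conductor-pred∈ cond) x x≤f)

  genus≤⌈conductor/2⌉ : ∀ {c} → 2 ∉ G → IsConductor G c → genus G ≤ ⌈ c / 2 ⌉
  genus≤⌈conductor/2⌉ {c} 2∉G cond = begin
    genus G                       ≡⟨ sym (countBelow-conductor unique cond) ⟩
    countBelow c G                ≤⟨ ∑-monoˡ-≤ (≤⌈/⌉* c 2) ⟩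
    countBelow (⌈ c / 2 ⌉ * 2) G  ≤⟨ countBelow-evens∉ (multiples∉ (s≤s z≤n) 2∉G) ⌈ c / 2 ⌉ ⟩
    ⌈ c / 2 ⌉                     ∎
    where open ≤-Reasoning

  ⌈conductor/m⌉≤⌈2*genus/3⌉ : ∀ {c} m .{{_ : NonZero m}} → 3 ≤ m → IsConductor G c →
                               ⌈ c / m ⌉ ≤ ⌈ 2 * genus G / 3 ⌉
  ⌈conductor/m⌉≤⌈2*genus/3⌉ {c} m 3≤m cond =
    ≤-trans (⌈/⌉-monoʳ-≥ c 3≤m) (⌈/⌉-monoˡ-≤ 3 (conductor≤2*genus cond))

1∉⇒genus≡0 : IsGapset G → 1 ∉ G → genus G ≡ 0
1∉⇒genus≡0 {[]}    _        _   = refl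
1∉⇒genus≡0 {x ∷ G} isGapset 1∉G =
  contradiction (subst (_∈ x ∷ G) (sym (*-identityʳ x)) (here refl)) (multiples∉ isGapset ≤-refl 1∉G x)

corollary6p3 : ∀ (g : ℕ) → 6 ≤ g →
    ∀ (q : ℕ) → ⌈ 2 * g / 3 ⌉ + 1 ≤ q → q ≤ g ∸ 1 →
    ∀ (G : List ℕ) (m c : ℕ) → IsGapset G → genus G ≡ g →
    IsMultiplicity G m → IsConductor G c → ¬ (⌈ c / m ⌉ ≡ q)
corollary6p3 _ _ _ _ _ _ zero _ _ _ ((() , _) , _) _ _
corollary6p3 _ 6≤g _ _ _ _ 1 _ isGapset refl ((_ , 1∉G) , _) _ _ =
  contradiction (subst (6 ≤_) (1∉⇒genus≡0 isGapset 1∉G) 6≤g) λ ()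
corollary6p3 _ 6≤g _ _ q≤g∸1 G 2 c isGapset refl ((_ , 2∉G) , _) cond refl =
  <⇒≱ (≤-<-trans q≤g∸1 g∸1<g) (genus≤⌈conductor/2⌉ isGapset 2∉G cond)
  where
  g∸1<g : genus G ∸ 1 < genus G
  g∸1<g = ∸-monoʳ-< ≤-refl (≤-trans (s≤s z≤n) 6≤g)
corollary6p3 _ _ _ ⌈2g/3⌉<q _ _ m@(suc (suc (suc _))) _ isGapset refl _ cond refl =
  m+1+n≰m _ (≤-trans ⌈2g/3⌉<q (⌈conductor/m⌉≤⌈2*genus/3⌉ isGapset m (s≤s (s≤s (s≤s z≤n))) cond))
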